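{- With the convention $|\mathrm{GS}_0|=1$, the numbers $|\mathrm{GS}_n|$ of generalized permutations satisfy, as formal power series in $t$, $$\frac{1}{\sqrt[3]{1-3t}}=\sum_{n=0}^\infty|\mathrm{GS}_n|\frac{t^n}{n!},$$ and for every $n\ge1$, $$|\mathrm{GS}_n|=\prod_{k=1}^n(3k-2)=\sum_{j=0}^{n-1}3^{j}\,|s(n,n-j)|,$$ where $s(n,m)$ are the Stirling numbers of the first kind.
   Context: A tile is a positive integer $m$ (its value) together with a marker that is either absent (tile written $m$), an up-arrow ($m\!\uparrow$) or a down-arrow ($m\!\downarrow$). For $n\ge1$ the set $\mathrm{GS}_n$ of generalized permutations of $[n]$ is defined recursively: $\mathrm{GS}_1$ contains only the word consisting of the unmarked tile $1$. For $n\ge2$, $\mathrm{GS}_n$ consists of all words obtained from some word $\pi=\pi_1\cdots\pi_{n-1}\in\mathrm{GS}_{n-1}$ by either (i) inserting the unmarked tile $n$ into any of the $n$ gaps of $\pi$ (before $\pi_1$, between consecutive tiles, or after $\pi_{n-1}$), or (ii) inserting the tile $n\!\uparrow$ immediately to the left of some $\pi_i$, $1\le i\le n-1$, or (iii) inserting the tile $n\!\downarrow$ immediately to the left of some $\pi_i$, $1\le i\le n-1$. -}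

module Defs where

open import Data.Nat using (ℕ; zero; suc; _*_; _+_; _∸_; _≤_; _<_; _!)
open import Data.Nat.Properties using (_!≢0)

open import Data.Fin using (Fin; inject₁)
open import Data.List using (List; []; _∷_; [_]; length; insertAt)
open import Data.List.Relation.Unary.Unique.Propositional using (Unique)
open import Data.List.Membership.Propositional using (_∈_)
open import Data.Product using (Σ; _×_)
open import Function.Bundles using (_⇔_)
open import Data.Integer using (ℤ; +_; -[1+_])
open import Data.Rational using (ℚ; 0ℚ; 1ℚ; _/_) renaming (_+_ to _+ℚ_; _*_ to _*ℚ_)
open import Relation.Binary.PropositionalEquality using (_≡_)

data Marker : Set where
  none up down : Marker

Tile : Set
Tile = ℕ × Marker

Word : Set
Word = List Tile

data GS : ℕ → Word → Set where
  base   : GS 1 [ (1 Data.Product., none) ]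
  insPlain : ∀ {n π} → GS n π → (i : Fin (suc (length π))) →
             GS (suc n) (insertAt π i (suc n Data.Product., none))
  -- (ii) tile (n+1)↑ immediately left of π_i
  insUp    : ∀ {n π} → GS n π → (i : Fin (length π)) →
             GS (suc n) (insertAt π (inject₁ i) (suc n Data.Product., up))
  -- (iii) tile (n+1)↓ immediately left of π_i
  insDown  : ∀ {n π} → GS n π → (i : Fin (length π)) →
             GS (suc n) (insertAt π (inject₁ i) (suc n Data.Product., down))

HasCard : (Word → Set) → ℕ → Set
HasCard P N = Σ (List Word) λ L → Unique L × (∀ w → (w ∈ L) ⇔ P w) × (length L ≡ N)

sumTo : ℕ → (ℕ → ℕ) → ℕ
sumTo zero    f = 0
sumTo (suc n) f = sumTo n f + f n

prodFrom1 : ℕ → (ℕ → ℕ) → ℕ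
prodFrom1 zero    f = 1
prodFrom1 (suc n) f = prodFrom1 n f * f (suc n)

-- unsigned Stirling numbers of the first kind  c n m = |s(n,m)|
stirling1 : ℕ → ℕ → ℕ
stirling1 zero    zero    = 1
stirling1 zero    (suc m) = 0
stirling1 (suc n) zero    = 0
stirling1 (suc n) (suc m) = n * stirling1 n (suc m) + stirling1 n m

PS : Set
PS = ℕ → ℚ

sumQ : ℕ → (ℕ → ℚ) → ℚ
sumQ zero    f = f 0
sumQ (suc n) f = sumQ n f +ℚ f (suc n)

_⊛_ : PS → PS → PS
(f ⊛ g) n = sumQ n (λ k → f k *ℚ g (n ∸ k))

_≈PS_ : PS → PS → Set
f ≈PS g = ∀ n → f n ≡ g n

onePS : PS
onePS zero    = 1ℚ
onePS (suc n) = 0ℚ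

-- 1 - 3t
oneMinus3t : PS
oneMinus3t zero          = 1ℚ
oneMinus3t (suc zero)    = -[1+ 2 ] / 1
oneMinus3t (suc (suc n)) = 0ℚ

egf : (ℕ → ℕ) → PS
egf a n = _/_ (+ a n) (n !) {{n !≢0}}

module Submission where

-- With a(n) = Π_{k=1}^{n} (3k - 2), the theorem splits into three independent parts.
--
-- Enumeration: an element of GS (n+1) is an element of GS n together with one of
-- its 3n + 1 slots for the new tile (n + 1 gaps for n+1, n places each for n+1↑
-- and n+1↓), and deleting the unique tile of value n + 1 recovers both.  So
-- inserting the new tile at every slot yields a duplicate-free list of a(n) words.
--
-- Stirling numbers: Σ_{j<n} x^j |s(n,n-j)| = Π_{k=1}^{n} (1 + (k-1) x) for n ≥ 1,
-- by the Stirling recurrence; take x = 3.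
--
-- Power series: a solution of (1 - r t) f′ = c f (in coefficient form) is fixed by
-- f(0), and by the Leibniz rule products of solutions are solutions, constants
-- adding.  With cbrt the solution for r = 3, c = -1, both cbrt³ and 1 - 3t solve the
-- equation for c = -3, and both cbrt · Σ a(n) tⁿ/n! and 1 solve it for c = 0.

module Enumeration where

  open import Relation.Binary.PropositionalEquality using (_≡_; refl; sym; trans; cong; cong₂; subst; module ≡-Reasoning)
  open import Data.Nat using (ℕ; zero; suc; _+_; _*_; _∸_; _≤_)
  open import Data.Nat.Properties using (≤-refl; m≤n⇒m≤1+n; 1+n≰n; *-suc)
  open import Data.Fin using (Fin; toℕ; inject₁)
  open import Data.Fin.Properties using (toℕ-injective; inject₁-injective)
  open import Data.List using (List; []; _∷_; [_]; length; map; concatMap; insertAt; allFin)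
  open import Data.List.Properties using (∷-injective; length-map; length-++; length-insertAt; length-tabulate)
  open import Data.List.Membership.Propositional using (_∈_; find; lose)
  open import Data.List.Membership.Propositional.Properties using (∈-map⁺; ∈-map⁻; ∈-allFin; ∈-concatMap⁺; ∈-concatMap⁻)
  open import Data.List.Relation.Unary.Any using (here; there)
  open import Data.List.Relation.Unary.All as All using (All; []; _∷_)
  open import Data.List.Relation.Unary.AllPairs using ([]; _∷_)
  open import Data.List.Relation.Unary.Unique.Propositional using (Unique)
  open import Data.List.Relation.Unary.Unique.Propositional.Properties using (map⁺; ++⁺; allFin⁺)
  open import Data.List.Relation.Binary.Disjoint.Propositional using (Disjoint)
  open import Data.Product using (Σ; _×_; _,_; proj₁; proj₂)
  open import Data.Empty using (⊥-elim)
  open import Relation.Nullary using (¬_)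
  open import Function using (_∘_)
  open import Function.Bundles using (mk⇔)
  open import Defs

  All-insertAt : ∀ {A : Set} {P : A → Set} xs (i : Fin (suc (length xs))) {t} →
                 All P xs → P t → All P (insertAt xs i t)
  All-insertAt xs       Fin.zero    all-xs      pt = pt ∷ all-xs
  All-insertAt (x ∷ xs) (Fin.suc i) (px ∷ all-xs) pt = px ∷ All-insertAt xs i all-xs pt

  insertAt-injective : ∀ {A : Set} {P : A → Set} {xs ys : List A} {s t : A}
                       (i : Fin (suc (length xs))) (j : Fin (suc (length ys))) →
                       All (¬_ ∘ P) xs → All (¬_ ∘ P) ys → P s → P t →
                       insertAt xs i s ≡ insertAt ys j t → xs ≡ ys × s ≡ t × toℕ i ≡ toℕ j
  insertAt-injective Fin.zero Fin.zero _ _ _ _ eq with ∷-injective eq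
  ... | s≡t , xs≡ys = xs≡ys , s≡t , refl
  insertAt-injective Fin.zero (Fin.suc j) _ (¬Py ∷ _) Ps _ refl = ⊥-elim (¬Py Ps)
  insertAt-injective (Fin.suc i) Fin.zero (¬Px ∷ _) _ _ Pt refl = ⊥-elim (¬Px Pt)
  insertAt-injective {xs = _ ∷ _} {_ ∷ _} (Fin.suc i) (Fin.suc j) (_ ∷ fresh-xs) (_ ∷ fresh-ys) Ps Pt eq
    with ∷-injective eq
  ... | x≡y , rest with insertAt-injective i j fresh-xs fresh-ys Ps Pt rest
  ...   | xs≡ys , s≡t , i≡j = cong₂ _∷_ x≡y xs≡ys , s≡t , cong suc i≡j

  concatMap-unique : ∀ {A B : Set} {f : A → List B} {xs : List A} → Unique xs →
                     (∀ {x} → x ∈ xs → Unique (f x)) →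
                     (∀ {x x′ y} → x ∈ xs → x′ ∈ xs → y ∈ f x → y ∈ f x′ → x ≡ x′) →
                     Unique (concatMap f xs)
  concatMap-unique {xs = []} [] _ _ = []
  concatMap-unique {f = f} {x ∷ xs} (x∉xs ∷ xs-unique) f-unique separated =
    ++⁺ (f-unique (here refl))
        (concatMap-unique xs-unique (f-unique ∘ there) (λ p q → separated (there p) (there q)))
        disjoint
    where
    disjoint : Disjoint (f x) (concatMap f xs)
    disjoint (y∈fx , y∈rest) with find (∈-concatMap⁻ f y∈rest)
    ... | x′ , x′∈xs , y∈fx′ = All.lookup x∉xs x′∈xs (separated (here refl) (there x′∈xs) y∈fx y∈fx′)

  length-concatMap-const : ∀ {A B : Set} (f : A → List B) {c} xs →
                           All (λ x → length (f x) ≡ c) xs → length (concatMap f xs) ≡ length xs * c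
  length-concatMap-const f []       []                 = refl
  length-concatMap-const f (x ∷ xs) (len-fx ∷ len-rest) =
    trans (length-++ (f x)) (cong₂ _+_ len-fx (length-concatMap-const f xs len-rest))

  -- A slot of a word with k tiles: an unmarked tile may go into any of the k + 1
  -- gaps, a marked tile immediately to the left of one of the k tiles.
  gaps : ℕ → Marker → ℕ
  gaps k none = suc k
  gaps k up   = k
  gaps k down = k

  Slot : ℕ → Set
  Slot k = Σ Marker (λ m → Fin (gaps k m))

  gap : ∀ {k} → Slot k → Fin (suc k)
  gap (none , i) = i
  gap (up   , i) = inject₁ i
  gap (down , i) = inject₁ i

  gap-injective : ∀ {k} m (i j : Fin (gaps k m)) → toℕ (gap (m , i)) ≡ toℕ (gap (m , j)) → i ≡ j
  gap-injective none i j eq = toℕ-injective eq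
  gap-injective up   i j eq = inject₁-injective (toℕ-injective eq)
  gap-injective down i j eq = inject₁-injective (toℕ-injective eq)

  markers : List Marker
  markers = none ∷ up ∷ down ∷ []

  markers-unique : Unique markers
  markers-unique = ((λ ()) ∷ (λ ()) ∷ []) ∷ ((λ ()) ∷ []) ∷ [] ∷ []

  ∈-markers : ∀ m → m ∈ markers
  ∈-markers none = here refl
  ∈-markers up   = there (here refl)
  ∈-markers down = there (there (here refl))

  slotsWith : ∀ k m → List (Slot k)
  slotsWith k m = map (m ,_) (allFin (gaps k m))

  slots : ∀ k → List (Slot k)
  slots k = concatMap (slotsWith k) markers

  ∈-slots : ∀ {k} (c : Slot k) → c ∈ slots k
  ∈-slots {k} (m , i) = ∈-concatMap⁺ (slotsWith k) (lose (∈-markers m) (∈-map⁺ (m ,_) (∈-allFin i)))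

  slots-unique : ∀ k → Unique (slots k)
  slots-unique k = concatMap-unique markers-unique (λ _ → map⁺ (λ { refl → refl }) (allFin⁺ _)) same-marker
    where
    marker-of : ∀ {m c} → c ∈ slotsWith k m → proj₁ c ≡ m
    marker-of c∈ with ∈-map⁻ _ c∈
    ... | _ , _ , refl = refl
    same-marker : ∀ {m m′ c} → m ∈ markers → m′ ∈ markers → c ∈ slotsWith k m → c ∈ slotsWith k m′ → m ≡ m′
    same-marker _ _ c∈ c∈′ = trans (sym (marker-of c∈)) (marker-of c∈′)

  length-slots : ∀ k → length (slots k) ≡ suc (3 * k)
  length-slots k = trans (length-++ (slotsWith k none))
    (cong₂ _+_ (count none) (trans (length-++ (slotsWith k up))
      (cong₂ _+_ (count up) (trans (length-++ (slotsWith k down)) (cong (_+ 0) (count down))))))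
    where
    count : ∀ m → length (slotsWith k m) ≡ gaps k m
    count m = trans (length-map {B = Slot k} (m ,_) (allFin (gaps k m))) (length-tabulate (λ i → i))

  insertTile : ℕ → (π : Word) → Slot (length π) → Word
  insertTile n π c = insertAt π (gap c) (suc n , proj₁ c)

  insertTile-GS : ∀ {n π} → GS n π → (c : Slot (length π)) → GS (suc n) (insertTile n π c)
  insertTile-GS g (none , i) = insPlain g i
  insertTile-GS g (up   , i) = insUp g i
  insertTile-GS g (down , i) = insDown g i

  Bounded : ℕ → Word → Set
  Bounded n = All (λ t → proj₁ t ≤ n)

  Shape : ℕ → Word → Set
  Shape n π = Bounded n π × length π ≡ n

  insertTile-shape : ∀ {n π} → Shape n π → (c : Slot (length π)) → Shape (suc n) (insertTile n π c)
  insertTile-shape {n} {π} (bounded , len) c =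
    All-insertAt π (gap c) (All.map m≤n⇒m≤1+n bounded) ≤-refl ,
    trans (length-insertAt π (gap c) _) (cong suc len)

  GS-shape : ∀ {n w} → GS n w → Shape n w
  GS-shape base           = (≤-refl ∷ []) , refl
  GS-shape (insPlain g i) = insertTile-shape (GS-shape g) (none , i)
  GS-shape (insUp g i)    = insertTile-shape (GS-shape g) (up , i)
  GS-shape (insDown g i)  = insertTile-shape (GS-shape g) (down , i)

  bounded⇒fresh : ∀ {n π} → Bounded n π → All (λ t → ¬ proj₁ t ≡ suc n) π
  bounded⇒fresh = All.map (λ t≤n t≡1+n → 1+n≰n (subst (_≤ _) t≡1+n t≤n))

  -- Deleting the tile n + 1 from an insertion recovers the word and the slot.
  insertTile-injectiveˡ : ∀ {n π π′} → Bounded n π → Bounded n π′ → ∀ c c′ →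
                          insertTile n π c ≡ insertTile n π′ c′ → π ≡ π′
  insertTile-injectiveˡ b b′ c c′ eq =
    proj₁ (insertAt-injective (gap c) (gap c′) (bounded⇒fresh b) (bounded⇒fresh b′) refl refl eq)

  insertTile-injectiveʳ : ∀ {n π} → Bounded n π → ∀ {c c′} → insertTile n π c ≡ insertTile n π c′ → c ≡ c′
  insertTile-injectiveʳ b {m , i} {_ , j} eq
    with insertAt-injective (gap (m , i)) (gap (_ , j)) (bounded⇒fresh b) (bounded⇒fresh b) refl refl eq
  ... | _ , refl , gap≡ = cong (m ,_) (gap-injective m i j gap≡)

  extensions : ℕ → Word → List Word
  extensions n π = map (insertTile n π) (slots (length π))

  ∈-extensions⁻ : ∀ {n π w} → w ∈ extensions n π → Σ (Slot (length π)) λ c → w ≡ insertTile n π c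
  ∈-extensions⁻ {n} {π} w∈ with ∈-map⁻ (insertTile n π) {xs = slots (length π)} w∈
  ... | c , _ , w≡ = c , w≡

  extensions-unique : ∀ {n π} → Bounded n π → Unique (extensions n π)
  extensions-unique b = map⁺ (insertTile-injectiveʳ b) (slots-unique _)

  length-extensions : ∀ n π → length (extensions n π) ≡ suc (3 * length π)
  length-extensions n π = trans (length-map (insertTile n π) (slots (length π))) (length-slots (length π))

  -- enumGS n lists the generalized permutations of [n + 1].
  enumGS : ℕ → List Word
  enumGS zero    = [ [ (1 , none) ] ]
  enumGS (suc n) = concatMap (extensions (suc n)) (enumGS n)

  enumGS-sound : ∀ n {w} → w ∈ enumGS n → GS (suc n) w
  enumGS-sound zero (here refl) = base
  enumGS-sound (suc n) w∈ with find (∈-concatMap⁻ (extensions (suc n)) {xs = enumGS n} w∈)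
  ... | π , π∈ , w∈ext with ∈-extensions⁻ w∈ext
  ...   | c , refl = insertTile-GS (enumGS-sound n π∈) c

  ∈-enumGS-extension : ∀ {n π} → π ∈ enumGS n → (c : Slot (length π)) → insertTile (suc n) π c ∈ enumGS (suc n)
  ∈-enumGS-extension {n} {π} π∈ c =
    ∈-concatMap⁺ (extensions (suc n)) {xs = enumGS n} (lose π∈ (∈-map⁺ (insertTile (suc n) π) (∈-slots c)))

  enumGS-complete : ∀ {n w} → GS (suc n) w → w ∈ enumGS n
  enumGS-complete base                     = here refl
  enumGS-complete (insPlain {zero} () _)
  enumGS-complete (insPlain {suc _} g i)   = ∈-enumGS-extension (enumGS-complete g) (none , i)
  enumGS-complete (insUp {zero} () _)
  enumGS-complete (insUp {suc _} g i)      = ∈-enumGS-extension (enumGS-complete g) (up , i)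
  enumGS-complete (insDown {zero} () _)
  enumGS-complete (insDown {suc _} g i)    = ∈-enumGS-extension (enumGS-complete g) (down , i)

  enumGS-shape : ∀ n {π} → π ∈ enumGS n → Shape (suc n) π
  enumGS-shape n = GS-shape ∘ enumGS-sound n

  -- Different words never share an extension, so the enumeration has no repetitions.
  enumGS-unique : ∀ n → Unique (enumGS n)
  enumGS-unique zero    = [] ∷ []
  enumGS-unique (suc n) =
    concatMap-unique (enumGS-unique n) (λ π∈ → extensions-unique (bounded π∈)) separated
    where
    bounded : ∀ {π} → π ∈ enumGS n → Bounded (suc n) π
    bounded = proj₁ ∘ enumGS-shape n
    separated : ∀ {π π′ w} → π ∈ enumGS n → π′ ∈ enumGS n →
                w ∈ extensions (suc n) π → w ∈ extensions (suc n) π′ → π ≡ π′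
    separated π∈ π′∈ w∈ w∈′ with ∈-extensions⁻ w∈ | ∈-extensions⁻ w∈′
    ... | c , refl | c′ , eq = insertTile-injectiveˡ (bounded π∈) (bounded π′∈) c c′ eq

  -- Every generalized permutation of [n + 1] has 3(n + 1) + 1 extensions.
  length-enumGS : ∀ n → length (enumGS n) ≡ prodFrom1 (suc n) (λ k → 3 * k ∸ 2)
  length-enumGS zero    = refl
  length-enumGS (suc n) = begin
      length (concatMap (extensions (suc n)) (enumGS n))
    ≡⟨ length-concatMap-const (extensions (suc n)) (enumGS n) (All.tabulate extensions-count) ⟩
      length (enumGS n) * suc (3 * suc n)
    ≡⟨ cong₂ _*_ (length-enumGS n) (sym (cong (_∸ 2) (*-suc 3 (suc n)))) ⟩
      prodFrom1 (suc n) (λ k → 3 * k ∸ 2) * (3 * suc (suc n) ∸ 2)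
    ∎
    where
    open ≡-Reasoning
    extensions-count : ∀ {π} → π ∈ enumGS n → length (extensions (suc n) π) ≡ suc (3 * suc n)
    extensions-count {π} π∈ = trans (length-extensions (suc n) π) (cong (λ k → suc (3 * k)) (proj₂ (enumGS-shape n π∈)))

  GS-count : ∀ n → HasCard (GS (suc n)) (prodFrom1 (suc n) (λ k → 3 * k ∸ 2))
  GS-count n = enumGS n , enumGS-unique n , (λ w → mk⇔ (enumGS-sound n) enumGS-complete) , length-enumGS n


module StirlingSums where

  open import Relation.Binary.PropositionalEquality using (_≡_; refl; sym; trans; cong; cong₂; module ≡-Reasoning)
  open import Data.Nat using (ℕ; zero; suc; _+_; _*_; _∸_; _^_; _<_; s≤s)
  open import Data.Nat.Properties using (≤-refl; ≤-pred; m≤n⇒m≤1+n; +-identityʳ; *-zeroʳ; +-assoc; +-comm; *-distribˡ-+; +-∸-assoc; n∸n≡0)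
  open import Data.Nat.Tactic.RingSolver using (solve-∀)
  open import Defs

  sumTo-cong : ∀ n {f g : ℕ → ℕ} → (∀ j → j < n → f j ≡ g j) → sumTo n f ≡ sumTo n g
  sumTo-cong zero    f≗g = refl
  sumTo-cong (suc n) f≗g = cong₂ _+_ (sumTo-cong n (λ j j<n → f≗g j (m≤n⇒m≤1+n j<n))) (f≗g n ≤-refl)

  sumTo-+ : ∀ n f g → sumTo n (λ j → f j + g j) ≡ sumTo n f + sumTo n g
  sumTo-+ zero    f g = refl
  sumTo-+ (suc n) f g = trans (cong (_+ (f n + g n)) (sumTo-+ n f g)) (interchange (sumTo n f) (sumTo n g) (f n) (g n))
    where
    interchange : ∀ a b c d → (a + b) + (c + d) ≡ (a + c) + (b + d)
    interchange = solve-∀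

  sumTo-*ˡ : ∀ n c f → sumTo n (λ j → c * f j) ≡ c * sumTo n f
  sumTo-*ˡ zero    c f = sym (*-zeroʳ c)
  sumTo-*ˡ (suc n) c f = trans (cong (_+ c * f n) (sumTo-*ˡ n c f)) (sym (*-distribˡ-+ c _ _))

  sumTo-shift : ∀ n f → sumTo (suc n) f ≡ f 0 + sumTo n (λ j → f (suc j))
  sumTo-shift zero    f = +-comm 0 (f 0)
  sumTo-shift (suc n) f = trans (cong (_+ f (suc n)) (sumTo-shift n f)) (+-assoc (f 0) _ _)

  prodFrom1-cong : ∀ n {f g : ℕ → ℕ} → (∀ k → f (suc k) ≡ g (suc k)) → prodFrom1 n f ≡ prodFrom1 n g
  prodFrom1-cong zero    f≗g = refl
  prodFrom1-cong (suc n) f≗g = cong₂ _*_ (prodFrom1-cong n f≗g) (f≗g n)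

  -- A permutation of m elements has at most m cycles.
  stirling1-vanishes : ∀ m k → m < k → stirling1 m k ≡ 0
  stirling1-vanishes zero    (suc k) _          = refl
  stirling1-vanishes (suc m) (suc k) (s≤s m<k) =
    trans (cong₂ (λ a b → m * a + b) (stirling1-vanishes m (suc k) (m≤n⇒m≤1+n m<k)) (stirling1-vanishes m k m<k))
          (trans (+-identityʳ (m * 0)) (*-zeroʳ m))

  stirlingSum : ℕ → ℕ → ℕ
  stirlingSum x n = sumTo n (λ j → x ^ j * stirling1 n (n ∸ j))

  -- The Stirling recurrence |s(m+1, i+1)| = m |s(m, i+1)| + |s(m, i)| turns into
  -- multiplication by 1 + m x (for m ≥ 1, where |s(m, 0)| = 0).
  stirlingSum-step : ∀ x n → stirlingSum x (suc (suc n)) ≡ stirlingSum x (suc n) * (1 + suc n * x)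
  stirlingSum-step x n = begin
      stirlingSum x (suc m)
    ≡⟨ sumTo-cong (suc m) recurrence ⟩
      sumTo (suc m) (λ j → T j + U j)
    ≡⟨ sumTo-+ (suc m) T U ⟩
      sumTo (suc m) T + sumTo (suc m) U
    ≡⟨ cong₂ _+_ sum-T sum-U ⟩
      S + (x * m) * S
    ≡⟨ factor x S m ⟩
      S * (1 + m * x)
    ∎
    where
    open ≡-Reasoning
    m = suc n
    S = stirlingSum x m
    T U : ℕ → ℕ
    T j = x ^ j * stirling1 m (m ∸ j)
    U j = x ^ j * (m * stirling1 m (suc (m ∸ j)))
    distrib : ∀ p a b → p * (a + b) ≡ p * b + p * a
    distrib = solve-∀
    factor : ∀ x s m → s + (x * m) * s ≡ s * (1 + m * x)
    factor = solve-∀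
    regroup : ∀ x p a c → x * p * (a * c) ≡ (x * a) * (p * c)
    regroup = solve-∀
    recurrence : ∀ j → j < suc m → x ^ j * stirling1 (suc m) (suc m ∸ j) ≡ T j + U j
    recurrence j (s≤s j≤m) = trans (cong (λ i → x ^ j * stirling1 (suc m) i) (+-∸-assoc 1 j≤m))
      (distrib (x ^ j) (m * stirling1 m (suc (m ∸ j))) (stirling1 m (m ∸ j)))
    -- the extra summand is x^m |s(m, 0)| = 0
    sum-T : sumTo (suc m) T ≡ S
    sum-T = trans (cong (λ i → S + x ^ m * stirling1 m i) (n∸n≡0 n))
                  (trans (cong (S +_) (*-zeroʳ (x ^ m))) (+-identityʳ S))
    -- the first summand contains |s(m, m+1)| = 0, the others are shifted copies of T
    sum-U : sumTo (suc m) U ≡ (x * m) * S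
    sum-U = begin
        sumTo (suc m) U
      ≡⟨ sumTo-shift m U ⟩
        U 0 + sumTo m (λ j → U (suc j))
      ≡⟨ cong (λ u → 1 * (m * u) + sumTo m (λ j → U (suc j))) (stirling1-vanishes m (suc m) ≤-refl) ⟩
        1 * (m * 0) + sumTo m (λ j → U (suc j))
      ≡⟨ cong (λ u → 1 * u + sumTo m (λ j → U (suc j))) (*-zeroʳ m) ⟩
        sumTo m (λ j → U (suc j))
      ≡⟨ sumTo-cong m shifted ⟩
        sumTo m (λ j → (x * m) * T j)
      ≡⟨ sumTo-*ˡ m (x * m) T ⟩
        (x * m) * S
      ∎
      where
      shifted : ∀ j → j < m → U (suc j) ≡ (x * m) * T j
      shifted j j<m = trans (cong (λ i → x * x ^ j * (m * stirling1 m i)) (sym (+-∸-assoc 1 {n} {j} (≤-pred j<m))))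
                            (regroup x (x ^ j) m (stirling1 m (m ∸ j)))

  stirlingSum-product : ∀ x n → stirlingSum x (suc n) ≡ prodFrom1 (suc n) (λ k → 1 + (k ∸ 1) * x)
  stirlingSum-product x zero    = refl
  stirlingSum-product x (suc n) =
    trans (stirlingSum-step x n) (cong (_* (1 + suc n * x)) (stirlingSum-product x n))


module PowerSeries where

  open import Relation.Binary.PropositionalEquality using (_≡_; refl; sym; trans; cong; cong₂; module ≡-Reasoning)
  open import Data.Nat as ℕ using (ℕ; zero; suc; NonZero; _∸_; _!; z≤n)
  import Data.Nat.Properties as ℕ
  open import Data.Integer as ℤ using (ℤ; +_)
  import Data.Integer.Properties as ℤ
  open import Data.Integer.Tactic.RingSolver using (solve-∀)
  open import Data.Rational using (ℚ; 0ℚ; 1ℚ; _+_; _*_; -_; _/_; toℚᵘ)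
  open import Data.Rational.Properties
    using (toℚᵘ-injective; toℚᵘ-homo-+; toℚᵘ-homo-*; toℚᵘ-fromℚᵘ; +-identityˡ; +-identityʳ; *-identityˡ; *-zeroˡ; *-zeroʳ; *-distribˡ-+; +-assoc; +-comm)
  open import Data.Rational.Unnormalised using (mkℚᵘ; 1ℚᵘ; *≡*) renaming (_≃_ to _≃ᵘ_)
  import Data.Rational.Unnormalised.Properties as ℚᵘ
  open import Data.Rational.Solver using (module +-*-Solver)
  open +-*-Solver using (solve; _:+_; _:*_; _:=_; con)
  open import Defs

  -- The embedding ℕ → ℚ, by iterated successor so that it is easy to reason about.
  ι : ℕ → ℚ
  ι zero    = 0ℚ
  ι (suc n) = 1ℚ + ι n

  ι-+ : ∀ m n → ι (m ℕ.+ n) ≡ ι m + ι n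
  ι-+ zero    n = sym (+-identityˡ (ι n))
  ι-+ (suc m) n = trans (cong (λ z → 1ℚ + z) (ι-+ m n)) (sym (+-assoc 1ℚ (ι m) (ι n)))

  ι-* : ∀ m n → ι (m ℕ.* n) ≡ ι m * ι n
  ι-* zero    n = sym (*-zeroˡ (ι n))
  ι-* (suc m) n = trans (ι-+ n (m ℕ.* n)) (trans (cong (λ z → ι n + z) (ι-* m n))
    (solve 2 (λ a b → b :+ a :* b := (con 1ℚ :+ a) :* b) refl (ι m) (ι n)))

  ι-toℚᵘ : ∀ n → toℚᵘ (ι n) ≃ᵘ mkℚᵘ (+ n) 0
  ι-toℚᵘ zero    = ℚᵘ.≃-refl
  ι-toℚᵘ (suc n) = ℚᵘ.≃-trans (toℚᵘ-homo-+ 1ℚ (ι n)) (ℚᵘ.≃-trans (ℚᵘ.+-congʳ 1ℚᵘ (ι-toℚᵘ n)) (*≡* cross))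
    where
    normalise : ∀ (z : ℤ) → (+ 1 ℤ.* + 1 ℤ.+ z ℤ.* + 1) ℤ.* + 1 ≡ (+ 1 ℤ.+ z) ℤ.* + 1
    normalise = solve-∀
    cross : (+ 1 ℤ.* + 1 ℤ.+ + n ℤ.* + 1) ℤ.* + 1 ≡ + suc n ℤ.* + 1
    cross = trans (normalise (+ n)) (cong (ℤ._* + 1) (sym (ℤ.pos-+ 1 n)))

  ι-/ : ∀ x d .{{_ : NonZero d}} → ι d * (+ x / d) ≡ ι x
  ι-/ x (suc k) = toℚᵘ-injective (ℚᵘ.≃-trans (toℚᵘ-homo-* (ι (suc k)) (+ x / suc k))
    (ℚᵘ.≃-trans (ℚᵘ.*-cong (ι-toℚᵘ (suc k)) (toℚᵘ-fromℚᵘ (mkℚᵘ (+ x) k)))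
    (ℚᵘ.≃-trans (*≡* cross) (ℚᵘ.≃-sym (ι-toℚᵘ x)))))
    where
    normalise : ∀ (a b : ℤ) → (a ℤ.* b) ℤ.* + 1 ≡ b ℤ.* (+ 1 ℤ.* a)
    normalise = solve-∀
    cross : (+ suc k ℤ.* + x) ℤ.* + 1 ≡ + x ℤ.* (+ (1 ℕ.* suc k))
    cross = trans (normalise (+ suc k) (+ x)) (cong (+ x ℤ.*_) (sym (ℤ.pos-* 1 (suc k))))

  ι-cancelˡ : ∀ d .{{_ : NonZero d}} p q → ι d * p ≡ ι d * q → p ≡ q
  ι-cancelˡ d p q eq = trans (sym (undo p)) (trans (cong ((+ 1 / d) *_) eq) (undo q))
    where
    undo : ∀ z → (+ 1 / d) * (ι d * z) ≡ z
    undo z = trans (solve 3 (λ a b c → a :* (b :* c) := (b :* a) :* c) refl (+ 1 / d) (ι d) z)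
                   (trans (cong (_* z) (ι-/ 1 d)) (*-identityˡ z))

  sumQ-cong : ∀ n {f g : ℕ → ℚ} → (∀ k → k ℕ.≤ n → f k ≡ g k) → sumQ n f ≡ sumQ n g
  sumQ-cong zero    f≗g = f≗g 0 z≤n
  sumQ-cong (suc n) f≗g = cong₂ _+_ (sumQ-cong n (λ k k≤n → f≗g k (ℕ.m≤n⇒m≤1+n k≤n))) (f≗g (suc n) ℕ.≤-refl)

  sumQ-+ : ∀ n f g → sumQ n (λ k → f k + g k) ≡ sumQ n f + sumQ n g
  sumQ-+ zero    f g = refl
  sumQ-+ (suc n) f g = trans (cong (_+ (f (suc n) + g (suc n))) (sumQ-+ n f g))
    (solve 4 (λ a b c d → (a :+ b) :+ (c :+ d) := (a :+ c) :+ (b :+ d)) refl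
       (sumQ n f) (sumQ n g) (f (suc n)) (g (suc n)))

  sumQ-*ˡ : ∀ n c f → sumQ n (λ k → c * f k) ≡ c * sumQ n f
  sumQ-*ˡ zero    c f = refl
  sumQ-*ˡ (suc n) c f = trans (cong (_+ c * f (suc n)) (sumQ-*ˡ n c f)) (sym (*-distribˡ-+ c _ _))

  sumQ-shift : ∀ n f → sumQ (suc n) f ≡ f 0 + sumQ n (λ k → f (suc k))
  sumQ-shift zero    f = refl
  sumQ-shift (suc n) f = trans (cong (_+ f (suc (suc n))) (sumQ-shift n f)) (+-assoc (f 0) _ _)

  -- The coefficient form of the differential equation (1 - r t) f′ = c f:
  -- comparing coefficients of t^n gives (n+1) f(n+1) - r n f(n) = c f(n).
  record ODE (r : ℕ) (c : ℚ) (f : PS) : Set where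
    constructor solves
    field coefficients : ∀ n → ι (suc n) * f (suc n) ≡ (ι (r ℕ.* n) + c) * f n

  ode-unique : ∀ {r c f g} → ODE r c f → ODE r c g → f 0 ≡ g 0 → f ≈PS g
  ode-unique f-ode g-ode f0≡g0 zero    = f0≡g0
  ode-unique {r} {c} {f} {g} f-ode g-ode f0≡g0 (suc n) = ι-cancelˡ (suc n) (f (suc n)) (g (suc n)) (begin
      ι (suc n) * f (suc n)       ≡⟨ ODE.coefficients f-ode n ⟩
      (ι (r ℕ.* n) + c) * f n     ≡⟨ cong ((ι (r ℕ.* n) + c) *_) (ode-unique f-ode g-ode f0≡g0 n) ⟩
      (ι (r ℕ.* n) + c) * g n     ≡⟨ sym (ODE.coefficients g-ode n) ⟩
      ι (suc n) * g (suc n)       ∎)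
    where open ≡-Reasoning

  -- Leibniz rule, coefficientwise: if (1 - r t) f′ = c₁ f and (1 - r t) g′ = c₂ g
  -- then (1 - r t) (f g)′ = (c₁ + c₂) f g.
  leibniz : ∀ r c₁ c₂ f g →
            (∀ n → ι (suc n) * f (suc n) ≡ (ι (r ℕ.* n) + c₁) * f n) →
            (∀ n → ι (suc n) * g (suc n) ≡ (ι (r ℕ.* n) + c₂) * g n) →
            ∀ n → ι (suc n) * (f ⊛ g) (suc n) ≡ (ι (r ℕ.* n) + (c₁ + c₂)) * (f ⊛ g) n
  leibniz r c₁ c₂ f g f-rec g-rec n = begin
      ι (suc n) * sumQ (suc n) (λ k → f k * g (suc n ∸ k))
    ≡⟨ sym (sumQ-*ˡ (suc n) (ι (suc n)) _) ⟩
      sumQ (suc n) (λ k → ι (suc n) * (f k * g (suc n ∸ k)))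
    ≡⟨ sumQ-cong (suc n) split-weight ⟩
      sumQ (suc n) (λ k → F k + G k)
    ≡⟨ sumQ-+ (suc n) F G ⟩
      sumQ (suc n) F + sumQ (suc n) G
    ≡⟨ cong₂ _+_ sum-F sum-G ⟩
      sumQ n F′ + sumQ n G′
    ≡⟨ sym (sumQ-+ n F′ G′) ⟩
      sumQ n (λ k → F′ k + G′ k)
    ≡⟨ sumQ-cong n merge-weight ⟩
      sumQ n (λ k → (ι (r ℕ.* n) + (c₁ + c₂)) * (f k * g (n ∸ k)))
    ≡⟨ sumQ-*ˡ n (ι (r ℕ.* n) + (c₁ + c₂)) (λ k → f k * g (n ∸ k)) ⟩
      (ι (r ℕ.* n) + (c₁ + c₂)) * sumQ n (λ k → f k * g (n ∸ k))
    ∎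
    where
    open ≡-Reasoning
    -- F, G: the parts of (fg)′ coming from f′ and g′; F′, G′: the same after using the ODEs
    F G F′ G′ : ℕ → ℚ
    F k  = (ι k * f k) * g (suc n ∸ k)
    G k  = f k * (ι (suc n ∸ k) * g (suc n ∸ k))
    F′ k = ((ι (r ℕ.* k) + c₁) * f k) * g (n ∸ k)
    G′ k = f k * ((ι (r ℕ.* (n ∸ k)) + c₂) * g (n ∸ k))
    split-weight : ∀ k → k ℕ.≤ suc n → ι (suc n) * (f k * g (suc n ∸ k)) ≡ F k + G k
    split-weight k k≤ = trans (cong (λ m → ι m * (f k * g (suc n ∸ k))) (sym (ℕ.m+[n∸m]≡n k≤)))
      (trans (cong (_* (f k * g (suc n ∸ k))) (ι-+ k (suc n ∸ k)))
        (solve 4 (λ a b x y → (a :+ b) :* (x :* y) := (a :* x) :* y :+ x :* (b :* y)) refl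
          (ι k) (ι (suc n ∸ k)) (f k) (g (suc n ∸ k))))
    -- the k = 0 summand of F vanishes; the others are f′ shifted
    sum-F : sumQ (suc n) F ≡ sumQ n F′
    sum-F = trans (sumQ-shift n F) (trans (cong (_+ sumQ n (λ k → F (suc k))) F0≡0)
              (trans (+-identityˡ _) (sumQ-cong n (λ k _ → cong (_* g (n ∸ k)) (f-rec k)))))
      where
      F0≡0 : F 0 ≡ 0ℚ
      F0≡0 = trans (cong (_* g (suc n)) (*-zeroˡ (f 0))) (*-zeroˡ (g (suc n)))
    -- the k = n+1 summand of G vanishes; the others are g′ shifted
    sum-G : sumQ (suc n) G ≡ sumQ n G′
    sum-G = trans (cong (λ z → sumQ n G + z) Glast≡0) (trans (+-identityʳ _)
              (sumQ-cong n λ k k≤n → trans (cong (λ m → f k * (ι m * g m)) (ℕ.+-∸-assoc 1 k≤n))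
                                           (cong (f k *_) (g-rec (n ∸ k)))))
      where
      Glast≡0 : G (suc n) ≡ 0ℚ
      Glast≡0 = trans (cong (λ m → f (suc n) * (ι m * g m)) (ℕ.n∸n≡0 n))
                  (trans (cong (f (suc n) *_) (*-zeroˡ (g 0))) (*-zeroʳ (f (suc n))))
    merge-weight : ∀ k → k ℕ.≤ n → F′ k + G′ k ≡ (ι (r ℕ.* n) + (c₁ + c₂)) * (f k * g (n ∸ k))
    merge-weight k k≤n = trans
      (solve 6 (λ a b x y p q → ((a :+ p) :* x) :* y :+ x :* ((b :+ q) :* y)
                               := ((a :+ b) :+ (p :+ q)) :* (x :* y)) refl
         (ι (r ℕ.* k)) (ι (r ℕ.* (n ∸ k))) (f k) (g (n ∸ k)) c₁ c₂)
      (cong (λ z → (z + (c₁ + c₂)) * (f k * g (n ∸ k))) (sym r-split))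
      where
      r-split : ι (r ℕ.* n) ≡ ι (r ℕ.* k) + ι (r ℕ.* (n ∸ k))
      r-split = trans (cong (λ m → ι (r ℕ.* m)) (sym (ℕ.m+[n∸m]≡n k≤n)))
                  (trans (cong ι (ℕ.*-distribˡ-+ r k (n ∸ k))) (ι-+ (r ℕ.* k) (r ℕ.* (n ∸ k))))

  ode-product : ∀ {r c₁ c₂ f g} → ODE r c₁ f → ODE r c₂ g → ODE r (c₁ + c₂) (f ⊛ g)
  ode-product {r} {c₁} {c₂} {f} {g} (solves f-rec) (solves g-rec) = solves (leibniz r c₁ c₂ f g f-rec g-rec)

  -- The solution with constant term 1, i.e. the series of (1 - r t)^(-c/r).
  odeSolution : ℕ → ℚ → PS
  odeSolution r c zero    = 1ℚ
  odeSolution r c (suc n) = (+ 1 / suc n) * ((ι (r ℕ.* n) + c) * odeSolution r c n)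

  -- It solves the equation because (n + 1) · 1/(n + 1) = 1.
  odeSolution-ode : ∀ r c → ODE r c (odeSolution r c)
  odeSolution-ode r c = solves λ n → let next = (ι (r ℕ.* n) + c) * odeSolution r c n in
    trans (solve 3 (λ a b x → a :* (b :* x) := (a :* b) :* x) refl (ι (suc n)) (+ 1 / suc n) next)
          (trans (cong (_* next) (ι-/ 1 (suc n))) (*-identityˡ next))

  egf-ode : ∀ r m a → (∀ n → a (suc n) ≡ a n ℕ.* (m ℕ.+ r ℕ.* n)) → ODE r (ι m) (egf a)
  egf-ode r m a a-rec = solves λ n → ι-cancelˡ (n !) {{ℕ._!≢0 n}} _ _ (begin
      ι (n !) * (ι (suc n) * egf a (suc n))
    ≡⟨ solve 3 (λ x y e → x :* (y :* e) := (y :* x) :* e) refl (ι (n !)) (ι (suc n)) (egf a (suc n)) ⟩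
      (ι (suc n) * ι (n !)) * egf a (suc n)
    ≡⟨ cong (_* egf a (suc n)) (sym (ι-* (suc n) (n !))) ⟩
      ι (suc n !) * egf a (suc n)
    ≡⟨ ι-/ (a (suc n)) (suc n !) {{ℕ._!≢0 (suc n)}} ⟩
      ι (a (suc n))
    ≡⟨ cong ι (a-rec n) ⟩
      ι (a n ℕ.* (m ℕ.+ r ℕ.* n))
    ≡⟨ trans (ι-* (a n) _) (cong (ι (a n) *_) (trans (ι-+ m (r ℕ.* n)) (+-comm (ι m) (ι (r ℕ.* n))))) ⟩
      ι (a n) * (ι (r ℕ.* n) + ι m)
    ≡⟨ cong (_* (ι (r ℕ.* n) + ι m)) (sym (ι-/ (a n) (n !) {{ℕ._!≢0 n}})) ⟩
      (ι (n !) * egf a n) * (ι (r ℕ.* n) + ι m)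
    ≡⟨ solve 3 (λ x e w → (x :* e) :* w := x :* (w :* e)) refl (ι (n !)) (egf a n) (ι (r ℕ.* n) + ι m) ⟩
      ι (n !) * ((ι (r ℕ.* n) + ι m) * egf a n)
    ∎)
    where open ≡-Reasoning

  onePS-ode : ∀ r → ODE r 0ℚ onePS
  onePS-ode r = solves coefficients
    where
    coefficients : ∀ n → ι (suc n) * onePS (suc n) ≡ (ι (r ℕ.* n) + 0ℚ) * onePS n
    coefficients zero    rewrite ℕ.*-zeroʳ r = refl
    coefficients (suc n) = trans (*-zeroʳ (ι (suc (suc n)))) (sym (*-zeroʳ (ι (r ℕ.* suc n) + 0ℚ)))

  oneMinus3t-ode : ODE 3 (- ι 3) oneMinus3t
  oneMinus3t-ode = solves coefficients
    where
    coefficients : ∀ n → ι (suc n) * oneMinus3t (suc n) ≡ (ι (3 ℕ.* n) + - ι 3) * oneMinus3t n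
    coefficients zero          = refl
    coefficients (suc zero)    = refl
    coefficients (suc (suc n)) =
      trans (*-zeroʳ (ι (suc (suc (suc n))))) (sym (*-zeroʳ (ι (3 ℕ.* suc (suc n)) + - ι 3)))

  cbrt : PS
  cbrt = odeSolution 3 (- 1ℚ)

  cbrt-ode : ODE 3 (- 1ℚ) cbrt
  cbrt-ode = odeSolution-ode 3 (- 1ℚ)

  -- The constants (-1 + -1) + -1 = -3 here, and -1 + 1 = 0 below, agree by computation.
  cbrt-cube : ((cbrt ⊛ cbrt) ⊛ cbrt) ≈PS oneMinus3t
  cbrt-cube = ode-unique (ode-product (ode-product cbrt-ode cbrt-ode) cbrt-ode) oneMinus3t-ode refl

  cbrt-inverse : ∀ a → a 0 ≡ 1 → (∀ n → a (suc n) ≡ a n ℕ.* (1 ℕ.+ 3 ℕ.* n)) →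
                 (cbrt ⊛ egf a) ≈PS onePS
  cbrt-inverse a a0≡1 a-rec =
    ode-unique (ode-product cbrt-ode (egf-ode 3 1 a a-rec)) (onePS-ode 3) (cong (λ x → 1ℚ * (+ x / 1)) a0≡1)


open import Defs
open import Data.Nat using (ℕ; suc; _+_; _*_; _∸_; _≤_; _^_)
open import Data.Nat.Properties using (*-suc; *-comm)
open import Data.Product using (Σ; _×_; _,_)
open import Relation.Binary.PropositionalEquality using (_≡_; refl; sym; trans; cong)
open Enumeration using (GS-count)
open StirlingSums using (stirlingSum-product; prodFrom1-cong)
open PowerSeries using (cbrt; cbrt-cube; cbrt-inverse)

-- a(n) = Π_{k=1}^{n} (3k - 2); the empty product gives a(0) = 1.
gsCount : ℕ → ℕ
gsCount n = prodFrom1 n (λ k → 3 * k ∸ 2)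

factor-suc : ∀ m → 3 * suc m ∸ 2 ≡ 1 + 3 * m
factor-suc m = cong (_∸ 2) (*-suc 3 m)

mainTheorem2 : Σ (ℕ → ℕ) λ a →
    (a 0 ≡ 1)
    × (∀ n → 1 ≤ n → HasCard (GS n) (a n))
    × (Σ PS λ R → (R 0 ≡ onePS 0) × ((R ⊛ R) ⊛ R) ≈PS oneMinus3t × (R ⊛ egf a) ≈PS onePS)
    × (∀ n → 1 ≤ n →
    (a n ≡ prodFrom1 n (λ k → 3 * k ∸ 2))
    × (a n ≡ sumTo n (λ j → 3 ^ j * stirling1 n (n ∸ j))))
mainTheorem2 =
  gsCount , refl , count , (cbrt , refl , cbrt-cube , cbrt-inverse gsCount refl recurrence) , formulas
  where
  count : ∀ n → 1 ≤ n → HasCard (GS n) (gsCount n)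
  count (suc n) _ = GS-count n
  recurrence : ∀ n → gsCount (suc n) ≡ gsCount n * (1 + 3 * n)
  recurrence n = cong (gsCount n *_) (factor-suc n)
  formulas : ∀ n → 1 ≤ n → (gsCount n ≡ prodFrom1 n (λ k → 3 * k ∸ 2))
                         × (gsCount n ≡ sumTo n (λ j → 3 ^ j * stirling1 n (n ∸ j)))
  formulas (suc n) _ = refl , sym (trans (stirlingSum-product 3 n)
    (prodFrom1-cong (suc n) (λ m → trans (cong (1 +_) (*-comm m 3)) (sym (factor-suc m)))))
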